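{- Let $K\subseteq L$ be finite fields, $C\subseteq L^m$ a $K$-linear code of dimension $k$ with generator matrix $A\in M_{k\times m}(L)$, and $f: C\to L^m$ a $K$-linear map. Let $U = K^k$, $\lambda\in\mathrm{Hom}_K(U,L^m)$, $\lambda(u) = A^Tu$ (so $\lambda(U)=C$), $\mu = f\lambda$, and $A'\in M_{k\times m}(L)$ with $\mu(u) = A'^Tu$ for all $u\in U$. Let $(V_1,\dots,V_m)$ and $(U_1,\dots,U_m)$ be the tuples of spaces of $A$ and $A'$ respectively. Then $f$ is an isometry (with respect to the Hamming metric) if and only if, as functions on $U$, $$\sum_{i=1}^m \frac{1}{|V_i|}\mathbf{1}_{V_i} = \sum_{i=1}^m\frac{1}{|U_i|}\mathbf{1}_{U_i}.$$
   Context: A generator matrix of $C$ has as rows a $K$-basis of $C$. Fix a $K$-basis $b_1,\dots,b_n$ of $L$. For a column $v\in L^k$ of a matrix in $M_{k\times m}(L)$ write $v=\sum_{j=1}^n b_jv_j$ with $v_j\in K^k$ (componentwise multiplication); its column space is $\langle v_1,\dots,v_n\rangle_K\subseteq U$. The tuple of spaces of the matrix is $(V_1,\dots,V_m)$, $V_i$ the column space of the $i$th column. $\mathbf{1}_Y$ is the indicator function of $Y$. -}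

module Defs where

open import Data.Nat using (ℕ; zero; suc)
open import Data.Fin using (Fin; zero; suc)
open import Data.Bool using (Bool; true; false; if_then_else_; _∧_)
open import Data.List using (List; []; _∷_; map; concatMap; filter; length)
import Data.List as List
open import Data.Bool.ListAction using (any)
open import Data.List.Membership.Propositional using (_∈_)
open import Data.List.Relation.Unary.Unique.Propositional using (Unique)
open import Data.Product using (Σ; ∃; _×_; _,_; proj₁)
open import Data.Rational using (ℚ; 0ℚ; _/_) renaming (_+_ to _+ℚ_)
open import Data.Integer using (+_)
open import Function using (_∘_)
open import Function.Bundles using (_⇔_)
open import Relation.Binary.PropositionalEquality using (_≡_; _≢_)
open import Relation.Binary.Definitions using (DecidableEquality)
open import Relation.Nullary.Decidable using (⌊_⌋)
open import Algebra.Core using (Op₁; Op₂)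
open import Algebra.Structures using (IsCommutativeRing)

record FiniteField : Set₁ where
  field
    Carrier  : Set
    _+_ _*_  : Op₂ Carrier
    -_       : Op₁ Carrier
    0# 1#    : Carrier
    isCommutativeRing : IsCommutativeRing _≡_ _+_ _*_ -_ 0# 1#
    _≟_      : DecidableEquality Carrier
    0≢1      : 0# ≢ 1#
    inverse  : ∀ x → x ≢ 0# → ∃ λ y → x * y ≡ 1#
    elements : List Carrier
    complete : ∀ x → x ∈ elements
    unique   : Unique elements

sumF : (F : FiniteField) → ∀ {p} → (Fin p → FiniteField.Carrier F) → FiniteField.Carrier F
sumF F {zero}  g = FiniteField.0# F
sumF F {suc p} g = FiniteField._+_ F (g zero) (sumF F (g ∘ suc))

record FieldExt : Set₁ where
  field
    K L : FiniteField
    ι   : FiniteField.Carrier K → FiniteField.Carrier L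
    ι-+ : ∀ x y → ι (FiniteField._+_ K x y) ≡ FiniteField._+_ L (ι x) (ι y)
    ι-* : ∀ x y → ι (FiniteField._*_ K x y) ≡ FiniteField._*_ L (ι x) (ι y)
    ι-1 : ι (FiniteField.1# K) ≡ FiniteField.1# L

record Basis (E : FieldExt) (n : ℕ) : Set where
  field
    b      : Fin n → FiniteField.Carrier (FieldExt.L E)
    coords : FiniteField.Carrier (FieldExt.L E) → Fin n → FiniteField.Carrier (FieldExt.K E)
    expand : ∀ l → l ≡ sumF (FieldExt.L E) {n}
                         (λ j → FiniteField._*_ (FieldExt.L E) (FieldExt.ι E (coords l j)) (b j))
    uniq   : ∀ l (c : Fin n → FiniteField.Carrier (FieldExt.K E)) → l ≡ sumF (FieldExt.L E) {n}
                         (λ j → FiniteField._*_ (FieldExt.L E) (FieldExt.ι E (c j)) (b j))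
             → ∀ j → coords l j ≡ c j

module Ops (E : FieldExt) {n : ℕ} (B : Basis E n) where
  open FieldExt E
  open Basis B
  module K = FiniteField K
  module L = FiniteField L

  KC = K.Carrier
  LC = L.Carrier

  KVec : ℕ → Set
  KVec k = Fin k → KC

  LVec : ℕ → Set
  LVec m = Fin m → LC

  Mat : ℕ → ℕ → Set
  Mat k m = Fin k → Fin m → LC

  _≗_ : ∀ {m} → LVec m → LVec m → Set
  x ≗ y = ∀ i → x i ≡ y i

  linMap : ∀ {k m} → Mat k m → KVec k → LVec m
  linMap A u i = sumF L (λ r → L._*_ (ι (u r)) (A r i))

  zeroL : ∀ {m} → LVec m
  zeroL i = L.0#

  lincomb : ∀ {m} → KC → LVec m → KC → LVec m → LVec m
  lincomb a x c y i = L._+_ (L._*_ (ι a) (x i)) (L._*_ (ι c) (y i))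

  RowsIndependent : ∀ {k m} → Mat k m → Set
  RowsIndependent {k} A = ∀ (u : KVec k) → linMap A u ≗ zeroL → ∀ r → u r ≡ K.0#

  IsGeneratorMatrix : ∀ {k m} → (LVec m → Set) → Mat k m → Set
  IsGeneratorMatrix {k} {m} C A =
    (∀ (x : LVec m) → C x ⇔ (∃ λ (u : KVec k) → linMap A u ≗ x)) × RowsIndependent A

  Sub : ∀ {m} → (LVec m → Set) → Set
  Sub {m} C = Σ (LVec m) C

  IsKLinear : ∀ {m} (C : LVec m → Set) → (Sub C → LVec m) → Set
  IsKLinear C f = ∀ (x y z : Sub C) (a c : KC) →
    proj₁ z ≗ lincomb a (proj₁ x) c (proj₁ y) → f z ≗ lincomb a (f x) c (f y)

  Represents : ∀ {k m} (C : LVec m → Set) → (Sub C → LVec m) → Mat k m → Mat k m → Set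
  Represents {k} C f A A' = ∀ (u : KVec k) (p : C (linMap A u)) → f (linMap A u , p) ≗ linMap A' u

  hamming : ∀ {m} → LVec m → LVec m → ℕ
  hamming {zero}  x y = 0
  hamming {suc m} x y =
    (if ⌊ x zero L.≟ y zero ⌋ then 0 else 1) Data.Nat.+ hamming (x ∘ suc) (y ∘ suc)

  IsIsometry : ∀ {m} (C : LVec m → Set) → (Sub C → LVec m) → Set
  IsIsometry C f = ∀ (x y : Sub C) → hamming (f x) (f y) ≡ hamming (proj₁ x) (proj₁ y)

  allVecs : (p : ℕ) → List (KVec p)
  allVecs zero    = (λ ()) ∷ []
  allVecs (suc p) = concatMap (λ a → map (λ v → λ { zero → a ; (suc j) → v j }) (allVecs p)) K.elements

  eqKVec : ∀ {p} → KVec p → KVec p → Bool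
  eqKVec {zero}  u v = true
  eqKVec {suc p} u v = ⌊ u zero K.≟ v zero ⌋ ∧ eqKVec (u ∘ suc) (v ∘ suc)

  -- v_j ∈ K^k for column i of M: the j-th coordinates of the entries of column i
  colVec : ∀ {k m} → Mat k m → Fin m → Fin n → KVec k
  colVec M i j r = coords (M r i) j

  colComb : ∀ {k m} → Mat k m → Fin m → KVec n → KVec k
  colComb M i c r = sumF K (λ j → K._*_ (c j) (colVec M i j r))

  inColSpace : ∀ {k m} → Mat k m → Fin m → KVec k → Bool
  inColSpace M i u = any (λ c → eqKVec u (colComb M i c)) (allVecs n)

  card : ∀ {k m} → Mat k m → Fin m → ℕ
  card {k} M i = length (List.filterᵇ (inColSpace M i) (allVecs k))

  -- 1 / N  (N = |V_i| ≥ 1 always, since 0 ∈ V_i)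
  inv : ℕ → ℚ
  inv zero    = 0ℚ
  inv (suc N) = + 1 / suc N

  sumℚ : ∀ {m} → (Fin m → ℚ) → ℚ
  sumℚ {zero}  g = 0ℚ
  sumℚ {suc m} g = g zero +ℚ sumℚ (g ∘ suc)

  weightFun : ∀ {k m} → Mat k m → KVec k → ℚ
  weightFun M u = sumℚ (λ i → if inColSpace M i u then inv (card M i) else 0ℚ)

-- Write q = |K| and, for the i-th column of a k × m matrix, φᵢ : Kⁿ → Kᵏ, c ↦ Σⱼ cⱼ vⱼ, so that Vᵢ = im φᵢ,
-- and Hᵢ(x) = |φᵢ⁻¹(x)|. Non-empty fibres are translates of ker φᵢ, hence |Vᵢ|·Hᵢ = qⁿ·1_{Vᵢ} and the
-- weight function of the matrix is (Σᵢ Hᵢ)/qⁿ. On the other hand the i-th coordinate of λ(u) vanishes iff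
-- u ⊥ Vᵢ, so wt λ(u) = m − N(u) with N(u) = #{i ∣ u ⊥ Vᵢ}, and the K-linear map f is an isometry iff
-- N is the same for A and A′. Finally Σᵢ Hᵢ and N determine each other: a linear form on Kᵖ that is not
-- zero takes every value exactly qᵖ⁻¹ times, and double counting gives
--   q·Σₓ Hᵢ(x)·[u·x = 0] = qⁿ·(if u ⊥ Vᵢ then q else 1),
--   qᵏ·Σ_c (if φᵢ(c) = x then q else 1) = qⁿ·Σᵤ (if u ⊥ Vᵢ then q·[u·x = 0] else 1).

module Submission where

open import Defs
open import Level using (0ℓ)
open import Data.Nat using (ℕ; zero; suc; pred; _+_; _*_; _^_; _≤_; z≤n; NonZero; >-nonZero; ≢-nonZero⁻¹)
import Data.Nat.Properties as ℕ
open import Data.Bool using (Bool; true; false; if_then_else_; _∧_; _∨_)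
open import Data.Fin using (Fin; zero; suc)
open import Data.List using (List; []; _∷_; _++_; map; concatMap; length; filterᵇ)
open import Data.List.Membership.Propositional using (_∈_)
open import Data.List.Relation.Unary.Any using (here; there; satisfied)
open import Data.List.Relation.Unary.Any.Properties using (any⁻)
open import Data.Bool.Properties using (T-≡)
open import Data.List.Relation.Unary.All using (All; []; _∷_)
import Data.List.Relation.Unary.All as All
open import Data.List.Relation.Unary.AllPairs using (_∷_)
open import Data.List.Relation.Unary.Unique.Propositional using (Unique)
open import Data.Bool.ListAction using (any)
open import Data.Product using (_,_; proj₁; proj₂)
open import Data.Empty using (⊥-elim)
open import Data.Vec.Functional using (Vector; zipWith) renaming ([] to []ᵛ; _∷_ to _∷ᵛ_)
open import Function using (id; _∘_; _⟨_⟩_)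
open import Function.Bundles using (_⇔_; mk⇔; Equivalence)
import Function.Properties.Equivalence as ⇔
import Data.Integer as ℤ
import Data.Integer.Properties as ℤ
open import Data.Rational using (ℚ; 0ℚ; _/_)
import Data.Rational as ℚ
import Data.Rational.Properties as ℚ
open import Data.Rational.Unnormalised as ℚᵘ using (mkℚᵘ; *≡*)
import Data.Rational.Unnormalised.Properties as ℚᵘ
open import Relation.Nullary using (Dec; yes; no)
open import Relation.Nullary.Decidable using (⌊_⌋; does-⇔; isYes≗does)
open import Relation.Binary.PropositionalEquality
  using (_≡_; _≢_; _≗_; refl; sym; trans; cong; cong₂; subst₂; module ≡-Reasoning)
open import Algebra.Bundles using (CommutativeRing)
import Algebra.Properties.Ring as RingProperties
open import Algebra.Properties.Semiring.Sum ℕ.+-*-semiring using (sum; sum-cong-≗; ∑-distrib-+; *-distribˡ-sum; *-distribʳ-sum)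
import Algebra.Properties.AbelianGroup as AbelianGroupProperties
import Algebra.Properties.CommutativeSemigroup as CommutativeSemigroupProperties

open ≡-Reasoning
open CommutativeSemigroupProperties ℕ.+-commutativeSemigroup using () renaming (interchange to +-interchange)
open CommutativeSemigroupProperties ℕ.*-commutativeSemigroup using () renaming (x∙yz≈y∙xz to x*yz≡y*xz)

⌊⌋-⇔ : ∀ {P Q : Set} → P ⇔ Q → (p? : Dec P) (q? : Dec Q) → ⌊ p? ⌋ ≡ ⌊ q? ⌋
⌊⌋-⇔ P⇔Q p? q? = trans (isYes≗does p?) (trans (does-⇔ P⇔Q p? q?) (sym (isYes≗does q?)))

true-⇔⇒≡ : ∀ {x y : Bool} → (x ≡ true ⇔ y ≡ true) → x ≡ y
true-⇔⇒≡ {true}  {true}  _   = refl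
true-⇔⇒≡ {true}  {false} x⇔y = sym (Equivalence.to x⇔y refl)
true-⇔⇒≡ {false} {true}  x⇔y = Equivalence.from x⇔y refl
true-⇔⇒≡ {false} {false} _   = refl

≡-⇔ : ∀ {A : Set} {x y x′ y′ : A} → x ≡ x′ → y ≡ y′ → (x ≡ y) ⇔ (x′ ≡ y′)
≡-⇔ refl refl = mk⇔ id id

𝟙 : Bool → ℕ
𝟙 true  = 1
𝟙 false = 0

module _ {A : Set} where

  sumOver : List A → (A → ℕ) → ℕ
  sumOver []       g = 0
  sumOver (x ∷ xs) g = g x + sumOver xs g

  sumOver-cong : ∀ xs {g h : A → ℕ} → (∀ a → g a ≡ h a) → sumOver xs g ≡ sumOver xs h
  sumOver-cong []       g≗h = refl
  sumOver-cong (x ∷ xs) g≗h = cong₂ _+_ (g≗h x) (sumOver-cong xs g≗h)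

  sumOver-distrib-+ : ∀ xs (g h : A → ℕ) →
    sumOver xs (λ a → g a + h a) ≡ sumOver xs g + sumOver xs h
  sumOver-distrib-+ []       g h = refl
  sumOver-distrib-+ (x ∷ xs) g h = begin
    (g x + h x) + sumOver xs (λ a → g a + h a)  ≡⟨ cong (g x + h x +_) (sumOver-distrib-+ xs g h) ⟩
    (g x + h x) + (sumOver xs g + sumOver xs h) ≡⟨ +-interchange (g x) (h x) _ _ ⟩
    (g x + sumOver xs g) + (h x + sumOver xs h) ∎

  *-distribˡ-sumOver : ∀ xs c (g : A → ℕ) → c * sumOver xs g ≡ sumOver xs (λ a → c * g a)
  *-distribˡ-sumOver []       c g = ℕ.*-zeroʳ c
  *-distribˡ-sumOver (x ∷ xs) c g =
    trans (ℕ.*-distribˡ-+ c (g x) _) (cong (c * g x +_) (*-distribˡ-sumOver xs c g))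

  sumOver-const : ∀ xs c → sumOver xs (λ _ → c) ≡ length xs * c
  sumOver-const []       c = refl
  sumOver-const (x ∷ xs) c = cong (c +_) (sumOver-const xs c)

  sumOver-++ : ∀ xs ys (g : A → ℕ) → sumOver (xs ++ ys) g ≡ sumOver xs g + sumOver ys g
  sumOver-++ []       ys g = refl
  sumOver-++ (x ∷ xs) ys g = trans (cong (g x +_) (sumOver-++ xs ys g)) (sym (ℕ.+-assoc (g x) _ _))

  sumOver-mono-≤ : ∀ xs {g h : A → ℕ} → (∀ a → g a ≤ h a) → sumOver xs g ≤ sumOver xs h
  sumOver-mono-≤ []       g≤h = ℕ.≤-refl
  sumOver-mono-≤ (x ∷ xs) g≤h = ℕ.+-mono-≤ (g≤h x) (sumOver-mono-≤ xs g≤h)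

  length-filterᵇ : ∀ (P : A → Bool) xs → length (filterᵇ P xs) ≡ sumOver xs (𝟙 ∘ P)
  length-filterᵇ P []       = refl
  length-filterᵇ P (x ∷ xs) with P x
  ... | true  = cong suc (length-filterᵇ P xs)
  ... | false = length-filterᵇ P xs

  sumOver-𝟙-¬any : ∀ (P : A → Bool) xs → any P xs ≡ false → sumOver xs (𝟙 ∘ P) ≡ 0
  sumOver-𝟙-¬any P []       _    = refl
  sumOver-𝟙-¬any P (x ∷ xs) ¬any with P x
  ... | false = sumOver-𝟙-¬any P xs ¬any

  module _ (_≟_ : (x y : A) → Dec (x ≡ y)) where

    sumOver-δ-∉ : ∀ xs x (g : A → ℕ) → All (x ≢_) xs → sumOver xs (λ s → 𝟙 ⌊ x ≟ s ⌋ * g s) ≡ 0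
    sumOver-δ-∉ []       x g []          = refl
    sumOver-δ-∉ (y ∷ xs) x g (x≢y ∷ x∉) with x ≟ y
    ... | yes x≡y = ⊥-elim (x≢y x≡y)
    ... | no  _   = sumOver-δ-∉ xs x g x∉

    sumOver-δ : ∀ xs → Unique xs → ∀ {x} → x ∈ xs → (g : A → ℕ) →
      sumOver xs (λ s → 𝟙 ⌊ x ≟ s ⌋ * g s) ≡ g x
    sumOver-δ (x ∷ xs) (x∉ ∷ _) (here refl) g with x ≟ x
    ... | yes _   = trans (cong₂ _+_ (ℕ.+-identityʳ (g x)) (sumOver-δ-∉ xs x g x∉)) (ℕ.+-identityʳ (g x))
    ... | no  x≢x = ⊥-elim (x≢x refl)
    sumOver-δ (y ∷ xs) (y∉ ∷ xs!) {x} (there x∈) g with x ≟ y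
    ... | yes refl = ⊥-elim (All.lookup y∉ x∈ refl)
    ... | no  _    = sumOver-δ xs xs! x∈ g

module _ {A B : Set} where

  sumOver-comm : ∀ (xs : List A) (ys : List B) (h : A → B → ℕ) →
    sumOver xs (λ a → sumOver ys (h a)) ≡ sumOver ys (λ b → sumOver xs (λ a → h a b))
  sumOver-comm []       ys h = sym (trans (sumOver-const ys 0) (ℕ.*-zeroʳ (length ys)))
  sumOver-comm (x ∷ xs) ys h =
    trans (cong (sumOver ys (h x) +_) (sumOver-comm xs ys h)) (sym (sumOver-distrib-+ ys (h x) _))

  sumOver-map : ∀ (f : A → B) xs (g : B → ℕ) → sumOver (map f xs) g ≡ sumOver xs (g ∘ f)
  sumOver-map f []       g = refl
  sumOver-map f (x ∷ xs) g = cong (g (f x) +_) (sumOver-map f xs g)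

  sumOver-concatMap : ∀ (f : A → List B) xs (g : B → ℕ) →
    sumOver (concatMap f xs) g ≡ sumOver xs (λ a → sumOver (f a) g)
  sumOver-concatMap f []       g = refl
  sumOver-concatMap f (x ∷ xs) g =
    trans (sumOver-++ (f x) _ g) (cong (sumOver (f x) g +_) (sumOver-concatMap f xs g))

sum-const : ∀ m c → sum {m} (λ _ → c) ≡ m * c
sum-const zero    c = refl
sum-const (suc m) c = cong (c +_) (sum-const m c)

sum-if-then-else-1 : ∀ {m} (b : Fin m → Bool) y →
  sum (λ i → if b i then y else 1) + sum (𝟙 ∘ b) ≡ m + sum (𝟙 ∘ b) * y
sum-if-then-else-1 {m} b y = begin
  sum (λ i → if b i then y else 1) + sum (𝟙 ∘ b)
    ≡⟨ ∑-distrib-+ (λ i → if b i then y else 1) (𝟙 ∘ b) ⟨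
  sum (λ i → (if b i then y else 1) + 𝟙 (b i))
    ≡⟨ sum-cong-≗ (λ i → pointwise (b i)) ⟩
  sum (λ i → 1 + 𝟙 (b i) * y)
    ≡⟨ ∑-distrib-+ {m} (λ _ → 1) (λ i → 𝟙 (b i) * y) ⟩
  sum {m} (λ _ → 1) + sum (λ i → 𝟙 (b i) * y)
    ≡⟨ cong₂ _+_ (trans (sum-const m 1) (ℕ.*-identityʳ m)) (sym (*-distribʳ-sum y (𝟙 ∘ b))) ⟩
  m + sum (𝟙 ∘ b) * y ∎
  where
  pointwise : ∀ c → (if c then y else 1) + 𝟙 c ≡ 1 + 𝟙 c * y
  pointwise true  = trans (ℕ.+-comm y 1) (cong suc (sym (ℕ.+-identityʳ y)))
  pointwise false = refl

module FixedDenominator (d-1 : ℕ) where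

  open import Data.Integer using (+_)

  frac : ℕ → ℚ
  frac h = + h / suc d-1

  frac-0 : frac 0 ≡ 0ℚ
  frac-0 = ℚ.0/n≡0 (suc d-1)

  frac-injective : ∀ {a b} → frac a ≡ frac b → a ≡ b
  frac-injective {a} {b} eq with ℚ.fromℚᵘ-injective {mkℚᵘ (+ a) d-1} {mkℚᵘ (+ b) d-1} eq
  ... | *≡* e = ℕ.*-cancelʳ-≡ a b (suc d-1) (ℤ.+-injective (trans (ℤ.pos-* a _) (trans e (sym (ℤ.pos-* b _)))))

  frac-+ : ∀ a b → frac a ℚ.+ frac b ≡ frac (a + b)
  frac-+ a b = ℚ.toℚᵘ-injective (ℚᵘ.≃-trans (ℚ.toℚᵘ-homo-+ (frac a) (frac b))
    (ℚᵘ.≃-trans (ℚᵘ.+-cong (ℚ.toℚᵘ-fromℚᵘ (mkℚᵘ (+ a) d-1)) (ℚ.toℚᵘ-fromℚᵘ (mkℚᵘ (+ b) d-1)))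
      (ℚᵘ.≃-trans sum≃ (ℚᵘ.≃-sym (ℚ.toℚᵘ-fromℚᵘ (mkℚᵘ (+ (a + b)) d-1))))))
    where
    D = + suc d-1
    sum≃ : mkℚᵘ (+ a) d-1 ℚᵘ.+ mkℚᵘ (+ b) d-1 ℚᵘ.≃ mkℚᵘ (+ (a + b)) d-1
    sum≃ = *≡* (begin
      (+ a ℤ.* D ℤ.+ + b ℤ.* D) ℤ.* D  ≡⟨ cong (ℤ._* D) (ℤ.*-distribʳ-+ D (+ a) (+ b)) ⟨
      (+ a ℤ.+ + b) ℤ.* D ℤ.* D        ≡⟨ ℤ.*-assoc (+ a ℤ.+ + b) D D ⟩
      (+ a ℤ.+ + b) ℤ.* (D ℤ.* D)      ≡⟨ cong₂ ℤ._*_ (ℤ.pos-+ a b) (ℤ.pos-* (suc d-1) (suc d-1)) ⟨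
      + (a + b) ℤ.* + (suc d-1 * suc d-1) ∎)
      where open ≡-Reasoning

  1/-frac : ∀ c h → suc c * h ≡ suc d-1 → + 1 / suc c ≡ frac h
  1/-frac c h e = ℚ.fromℚᵘ-cong {mkℚᵘ (+ 1) c} {mkℚᵘ (+ h) d-1} (*≡* (begin
    + 1 ℤ.* + suc d-1    ≡⟨ ℤ.pos-* 1 (suc d-1) ⟨
    + (1 * suc d-1)      ≡⟨ cong +_ (trans (ℕ.*-identityˡ _) (trans (sym e) (ℕ.*-comm (suc c) h))) ⟩
    + (h * suc c)        ≡⟨ ℤ.pos-* h (suc c) ⟩
    + h ℤ.* + suc c      ∎))

module FieldProperties (𝔽 : FiniteField) where

  open FiniteField 𝔽 using (Carrier; _≟_; 0≢1; inverse; elements; complete; unique)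

  commutativeRing : CommutativeRing 0ℓ 0ℓ
  commutativeRing = record { isCommutativeRing = FiniteField.isCommutativeRing 𝔽 }

  module F where
    open CommutativeRing commutativeRing public
    open RingProperties ring public using (x+x≈x⇒x≈0; x[y-z]≈xy-xz; [y-z]x≈yx-zx)
    open AbelianGroupProperties +-abelianGroup public
      using (x∙y⁻¹≈ε⇒x≈y; x≈y⇒x∙y⁻¹≈ε; ε⁻¹≈ε; ⁻¹-∙-comm; inverseʳ-unique)
    open CommutativeSemigroupProperties +-commutativeSemigroup public
      using () renaming (interchange to +-interchange)
    open CommutativeSemigroupProperties *-commutativeSemigroup public
      using () renaming (x∙yz≈y∙xz to x*yz≡y*xz)

  infix 4 _==_
  _==_ : Carrier → Carrier → Bool
  x == y = ⌊ x ≟ y ⌋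

  ==-⇔ : ∀ {x y x′ y′} → (x ≡ y) ⇔ (x′ ≡ y′) → (x == y) ≡ (x′ == y′)
  ==-⇔ e = ⌊⌋-⇔ e (_ ≟ _) (_ ≟ _)

  ==≡true⇔≡ : ∀ {x y} → (x == y) ≡ true ⇔ x ≡ y
  ==≡true⇔≡ {x} {y} with x ≟ y
  ... | yes x≡y = mk⇔ (λ _ → x≡y) (λ _ → refl)
  ... | no  x≢y = mk⇔ (λ ()) (⊥-elim ∘ x≢y)

  ==-refl : ∀ x → (x == x) ≡ true
  ==-refl x = Equivalence.from ==≡true⇔≡ refl

  ∑F : ∀ {p} → Vector Carrier p → Carrier
  ∑F = sumF 𝔽

  ∑F-cong : ∀ {p} {f g : Vector Carrier p} → (∀ j → f j ≡ g j) → ∑F f ≡ ∑F g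
  ∑F-cong {zero}  f≗g = refl
  ∑F-cong {suc p} f≗g = cong₂ F._+_ (f≗g zero) (∑F-cong (f≗g ∘ suc))

  ∑F-zero : ∀ p → ∑F {p} (λ _ → F.0#) ≡ F.0#
  ∑F-zero zero    = refl
  ∑F-zero (suc p) = trans (cong (F.0# F.+_) (∑F-zero p)) (F.+-identityˡ F.0#)

  ∑F-distrib-+ : ∀ {p} (f g : Vector Carrier p) → ∑F (λ j → f j F.+ g j) ≡ ∑F f F.+ ∑F g
  ∑F-distrib-+ {zero}  f g = sym (F.+-identityˡ F.0#)
  ∑F-distrib-+ {suc p} f g =
    trans (cong (f zero F.+ g zero F.+_) (∑F-distrib-+ (f ∘ suc) (g ∘ suc))) (F.+-interchange _ _ _ _)

  ∑F-distrib-- : ∀ {p} (f g : Vector Carrier p) → ∑F (λ j → f j F.- g j) ≡ ∑F f F.- ∑F g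
  ∑F-distrib-- {zero}  f g = sym (trans (F.+-identityˡ (F.- F.0#)) F.ε⁻¹≈ε)
  ∑F-distrib-- {suc p} f g = begin
    (f zero F.- g zero) F.+ ∑F (λ j → f (suc j) F.- g (suc j))
      ≡⟨ cong (f zero F.- g zero F.+_) (∑F-distrib-- (f ∘ suc) (g ∘ suc)) ⟩
    (f zero F.- g zero) F.+ (∑F (f ∘ suc) F.- ∑F (g ∘ suc))
      ≡⟨ F.+-interchange _ _ _ _ ⟩
    ∑F f F.+ (F.- g zero F.+ F.- ∑F (g ∘ suc))
      ≡⟨ cong (∑F f F.+_) (F.⁻¹-∙-comm _ _) ⟩
    ∑F f F.- ∑F g ∎

  *-distribˡ-∑F : ∀ {p} c (f : Vector Carrier p) → c F.* ∑F f ≡ ∑F (λ j → c F.* f j)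
  *-distribˡ-∑F {zero}  c f = F.zeroʳ c
  *-distribˡ-∑F {suc p} c f =
    trans (F.distribˡ c (f zero) _) (cong (c F.* f zero F.+_) (*-distribˡ-∑F c (f ∘ suc)))

  ∑F-comm : ∀ {p r} (h : Fin p → Fin r → Carrier) → ∑F (λ i → ∑F (h i)) ≡ ∑F (λ j → ∑F (λ i → h i j))
  ∑F-comm {zero}  {r} h = sym (∑F-zero r)
  ∑F-comm {suc p}     h = trans (cong (∑F (h zero) F.+_) (∑F-comm (h ∘ suc))) (sym (∑F-distrib-+ (h zero) _))

  x+y-y≡x : ∀ x y → (x F.+ y) F.- y ≡ x
  x+y-y≡x x y = trans (F.+-assoc x y (F.- y)) (trans (cong (x F.+_) (F.-‿inverseʳ y)) (F.+-identityʳ x))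

  x-y+y≡x : ∀ x y → (x F.- y) F.+ y ≡ x
  x-y+y≡x x y = trans (F.+-assoc x (F.- y) y) (trans (cong (x F.+_) (F.-‿inverseˡ y)) (F.+-identityʳ x))

  x-y≡0⇔x≡y : ∀ x y → (x F.- y ≡ F.0#) ⇔ (x ≡ y)
  x-y≡0⇔x≡y x y = mk⇔ (F.x∙y⁻¹≈ε⇒x≈y x y) F.x≈y⇒x∙y⁻¹≈ε

  x≡y+x⇔0≡y : ∀ x y → (x ≡ y F.+ x) ⇔ (F.0# ≡ y)
  x≡y+x⇔0≡y x y = mk⇔
    (λ x≡y+x → trans (sym (F.-‿inverseʳ x)) (trans (cong (F._- x) x≡y+x) (x+y-y≡x y x)))
    (λ { refl → sym (F.+-identityˡ x) })

  q : ℕ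
  q = length elements

  ∑ : (Carrier → ℕ) → ℕ
  ∑ = sumOver elements

  ∑-cong : ∀ {g h : Carrier → ℕ} → (∀ a → g a ≡ h a) → ∑ g ≡ ∑ h
  ∑-cong = sumOver-cong elements

  ∑-const : ∀ c → ∑ (λ _ → c) ≡ q * c
  ∑-const = sumOver-const elements

  ∑-δ : ∀ x (g : Carrier → ℕ) → ∑ (λ s → 𝟙 (x == s) * g s) ≡ g x
  ∑-δ x g = sumOver-δ _≟_ elements unique (complete x) g

  ∑-𝟙-== : ∀ x → ∑ (λ s → 𝟙 (x == s)) ≡ 1
  ∑-𝟙-== x = trans (∑-cong (λ s → sym (ℕ.*-identityʳ _))) (∑-δ x (λ _ → 1))

  -- Each summand g (a + d) is rewritten as a δ-sum, which is then reindexed by s ↦ s - d.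
  ∑-translate : ∀ (g : Carrier → ℕ) d → ∑ (λ a → g (a F.+ d)) ≡ ∑ g
  ∑-translate g d = begin
    ∑ (λ a → g (a F.+ d))
      ≡⟨ ∑-cong (λ a → ∑-δ (a F.+ d) g) ⟨
    ∑ (λ a → ∑ (λ s → 𝟙 (a F.+ d == s) * g s))
      ≡⟨ sumOver-comm elements elements _ ⟩
    ∑ (λ s → ∑ (λ a → 𝟙 (a F.+ d == s) * g s))
      ≡⟨ ∑-cong (λ s → ∑-cong (λ a → cong (λ b → 𝟙 b * g s) (==-⇔ (shift a s)))) ⟩
    ∑ (λ s → ∑ (λ a → 𝟙 (s F.- d == a) * g s))
      ≡⟨ ∑-cong (λ s → ∑-δ (s F.- d) (λ _ → g s)) ⟩
    ∑ g ∎
    where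
    shift : ∀ a s → (a F.+ d ≡ s) ⇔ (s F.- d ≡ a)
    shift a s = mk⇔ (λ { refl → x+y-y≡x a d }) (λ { refl → x-y+y≡x s d })

  2≤q : 2 ≤ q
  2≤q = subst₂ _≤_ two (trans (∑-const 1) (ℕ.*-identityʳ q)) (sumOver-mono-≤ elements at-most-one)
    where
    two : ∑ (λ s → 𝟙 (F.0# == s) + 𝟙 (F.1# == s)) ≡ 2
    two = trans (sumOver-distrib-+ elements _ _) (cong₂ _+_ (∑-𝟙-== F.0#) (∑-𝟙-== F.1#))
    at-most-one : ∀ s → 𝟙 (F.0# == s) + 𝟙 (F.1# == s) ≤ 1
    at-most-one s with F.0# ≟ s | F.1# ≟ s
    ... | yes refl | yes 1≡0 = ⊥-elim (0≢1 (sym 1≡0))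
    ... | yes _    | no  _   = ℕ.≤-refl
    ... | no  _    | yes _   = ℕ.≤-refl
    ... | no  _    | no  _   = z≤n

  instance
    q-nonZero : NonZero q
    q-nonZero = >-nonZero (ℕ.≤-trans (ℕ.n≤1+n 1) 2≤q)

    pred-q-nonZero : NonZero (pred q)
    pred-q-nonZero = >-nonZero (ℕ.pred-mono-≤ 2≤q)

  q*𝟙[0==0]≡q : q * 𝟙 (F.0# == F.0#) ≡ q
  q*𝟙[0==0]≡q = trans (cong (λ b → q * 𝟙 b) (==-refl F.0#)) (ℕ.*-identityʳ q)

  if-q≡1+pred-q : ∀ b → (if b then q else 1) ≡ 1 + pred q * 𝟙 b
  if-q≡1+pred-q true  = trans (sym (ℕ.suc-pred q)) (cong suc (sym (ℕ.*-identityʳ (pred q))))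
  if-q≡1+pred-q false = cong suc (sym (ℕ.*-zeroʳ (pred q)))

  ∑ᵛ : ∀ p → (Vector Carrier p → ℕ) → ℕ
  ∑ᵛ zero    g = g []ᵛ
  ∑ᵛ (suc p) g = ∑ (λ a → ∑ᵛ p (λ v → g (a ∷ᵛ v)))

  Extensional : ∀ {p} {A : Set} → (Vector Carrier p → A) → Set
  Extensional g = ∀ {u v} → u ≗ v → g u ≡ g v

  ∷ᵛ-extensional : ∀ {p} {A : Set} {g : Vector Carrier (suc p) → A} → Extensional g →
    ∀ a → Extensional (λ v → g (a ∷ᵛ v))
  ∷ᵛ-extensional g-ext a u≗v = g-ext λ { zero → refl ; (suc j) → u≗v j }

  ∑ᵛ-cong : ∀ p {g h : Vector Carrier p → ℕ} → (∀ v → g v ≡ h v) → ∑ᵛ p g ≡ ∑ᵛ p h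
  ∑ᵛ-cong zero    g≗h = g≗h []ᵛ
  ∑ᵛ-cong (suc p) g≗h = ∑-cong (λ a → ∑ᵛ-cong p (λ v → g≗h (a ∷ᵛ v)))

  ∑ᵛ-distrib-+ : ∀ p (g h : Vector Carrier p → ℕ) → ∑ᵛ p (λ v → g v + h v) ≡ ∑ᵛ p g + ∑ᵛ p h
  ∑ᵛ-distrib-+ zero    g h = refl
  ∑ᵛ-distrib-+ (suc p) g h = trans (∑-cong (λ a → ∑ᵛ-distrib-+ p _ _)) (sumOver-distrib-+ elements _ _)

  *-distribˡ-∑ᵛ : ∀ p c (g : Vector Carrier p → ℕ) → c * ∑ᵛ p g ≡ ∑ᵛ p (λ v → c * g v)
  *-distribˡ-∑ᵛ zero    c g = refl
  *-distribˡ-∑ᵛ (suc p) c g = trans (*-distribˡ-sumOver elements c _) (∑-cong (λ a → *-distribˡ-∑ᵛ p c _))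

  ∑ᵛ-const : ∀ p c → ∑ᵛ p (λ _ → c) ≡ q ^ p * c
  ∑ᵛ-const zero    c = sym (ℕ.+-identityʳ c)
  ∑ᵛ-const (suc p) c = trans (∑-cong (λ _ → ∑ᵛ-const p c)) (trans (∑-const _) (sym (ℕ.*-assoc q (q ^ p) c)))

  ∑ᵛ-∑-comm : ∀ p (h : Carrier → Vector Carrier p → ℕ) →
    ∑ᵛ p (λ v → ∑ (λ a → h a v)) ≡ ∑ (λ a → ∑ᵛ p (h a))
  ∑ᵛ-∑-comm zero    h = refl
  ∑ᵛ-∑-comm (suc p) h =
    trans (∑-cong (λ b → ∑ᵛ-∑-comm p (λ a v → h a (b ∷ᵛ v)))) (sumOver-comm elements elements _)

  ∑ᵛ-comm : ∀ p r (h : Vector Carrier p → Vector Carrier r → ℕ) →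
    ∑ᵛ p (λ u → ∑ᵛ r (h u)) ≡ ∑ᵛ r (λ v → ∑ᵛ p (λ u → h u v))
  ∑ᵛ-comm zero    r h = refl
  ∑ᵛ-comm (suc p) r h =
    trans (∑-cong (λ a → ∑ᵛ-comm p r (λ u → h (a ∷ᵛ u))))
          (sym (∑ᵛ-∑-comm r (λ a v → ∑ᵛ p (λ u → h (a ∷ᵛ u) v))))

  infixl 6 _+ᵛ_
  _+ᵛ_ : ∀ {p} → Vector Carrier p → Vector Carrier p → Vector Carrier p
  _+ᵛ_ = zipWith F._+_

  ∑ᵛ-translate : ∀ p (g : Vector Carrier p → ℕ) → Extensional g →
    ∀ d → ∑ᵛ p (λ c → g (c +ᵛ d)) ≡ ∑ᵛ p g
  ∑ᵛ-translate zero    g g-ext d = g-ext (λ ())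
  ∑ᵛ-translate (suc p) g g-ext d = begin
    ∑ (λ a → ∑ᵛ p (λ v → g ((a ∷ᵛ v) +ᵛ d)))
      ≡⟨ ∑-cong (λ a → ∑ᵛ-cong p (λ v → g-ext λ { zero → refl ; (suc j) → refl })) ⟩
    ∑ (λ a → ∑ᵛ p (λ v → g ((a F.+ d zero) ∷ᵛ (v +ᵛ d ∘ suc))))
      ≡⟨ ∑-cong (λ a → ∑ᵛ-translate p _ (∷ᵛ-extensional g-ext _) (d ∘ suc)) ⟩
    ∑ (λ a → ∑ᵛ p (λ v → g ((a F.+ d zero) ∷ᵛ v)))
      ≡⟨ ∑-translate (λ a → ∑ᵛ p (λ v → g (a ∷ᵛ v))) (d zero) ⟩
    ∑ (λ a → ∑ᵛ p (λ v → g (a ∷ᵛ v))) ∎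

  ∑ᵛ-if-q : ∀ p (f : Vector Carrier p → Bool) →
    ∑ᵛ p (λ c → if f c then q else 1) ≡ q ^ p + pred q * ∑ᵛ p (𝟙 ∘ f)
  ∑ᵛ-if-q p f = begin
    ∑ᵛ p (λ c → if f c then q else 1)
      ≡⟨ ∑ᵛ-cong p (if-q≡1+pred-q ∘ f) ⟩
    ∑ᵛ p (λ c → 1 + pred q * 𝟙 (f c))
      ≡⟨ ∑ᵛ-distrib-+ p _ _ ⟩
    ∑ᵛ p (λ _ → 1) + ∑ᵛ p (λ c → pred q * 𝟙 (f c))
      ≡⟨ cong₂ _+_ (trans (∑ᵛ-const p 1) (ℕ.*-identityʳ _)) (sym (*-distribˡ-∑ᵛ p (pred q) _)) ⟩
    q ^ p + pred q * ∑ᵛ p (𝟙 ∘ f) ∎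

  sum-if-q : ∀ {m} (b : Fin m → Bool) → sum (λ i → if b i then q else 1) ≡ m + pred q * sum (𝟙 ∘ b)
  sum-if-q {m} b = begin
    sum (λ i → if b i then q else 1)
      ≡⟨ sum-cong-≗ (if-q≡1+pred-q ∘ b) ⟩
    sum (λ i → 1 + pred q * 𝟙 (b i))
      ≡⟨ ∑-distrib-+ {m} (λ _ → 1) _ ⟩
    sum {m} (λ _ → 1) + sum (λ i → pred q * 𝟙 (b i))
      ≡⟨ cong₂ _+_ (trans (sum-const m 1) (ℕ.*-identityʳ m)) (sym (*-distribˡ-sum (pred q) (𝟙 ∘ b))) ⟩
    m + pred q * sum (𝟙 ∘ b) ∎

  sum-∑ᵛ-comm : ∀ {m} p (f : Fin m → Vector Carrier p → ℕ) →
    sum (λ i → ∑ᵛ p (f i)) ≡ ∑ᵛ p (λ u → sum (λ i → f i u))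
  sum-∑ᵛ-comm {zero}  p f = sym (trans (∑ᵛ-const p 0) (ℕ.*-zeroʳ (q ^ p)))
  sum-∑ᵛ-comm {suc m} p f =
    trans (cong (∑ᵛ p (f zero) +_) (sum-∑ᵛ-comm p (f ∘ suc))) (sym (∑ᵛ-distrib-+ p _ _))

  dot : ∀ {p} → Vector Carrier p → Vector Carrier p → Carrier
  dot u w = ∑F (λ r → u r F.* w r)

  dot-congʳ : ∀ {p} (u : Vector Carrier p) {a b} → a ≗ b → dot u a ≡ dot u b
  dot-congʳ u a≗b = ∑F-cong (λ r → cong (u r F.*_) (a≗b r))

  infixl 6 _-ᵛ_
  _-ᵛ_ : ∀ {p} → Vector Carrier p → Vector Carrier p → Vector Carrier p
  _-ᵛ_ = zipWith F._-_

  dot-distrib-- : ∀ {p} (u a b : Vector Carrier p) → dot u (a -ᵛ b) ≡ dot u a F.- dot u b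
  dot-distrib-- u a b =
    trans (∑F-cong (λ r → F.x[y-z]≈xy-xz (u r) (a r) (b r))) (∑F-distrib-- (λ r → u r F.* a r) (λ r → u r F.* b r))

  isZero : ∀ {p} → Vector Carrier p → Bool
  isZero {zero}  a = true
  isZero {suc p} a = (a zero == F.0#) ∧ isZero (a ∘ suc)

  isZero-⇔ : ∀ {p} (a : Vector Carrier p) → isZero a ≡ true ⇔ (∀ j → a j ≡ F.0#)
  isZero-⇔ {zero}  a = mk⇔ (λ _ ()) (λ _ → refl)
  isZero-⇔ {suc p} a with a zero ≟ F.0#
  ... | yes a₀≡0 = mk⇔ (λ a'≡0 → λ { zero → a₀≡0 ; (suc j) → Equivalence.to (isZero-⇔ (a ∘ suc)) a'≡0 j })
                       (λ a≡0 → Equivalence.from (isZero-⇔ (a ∘ suc)) (a≡0 ∘ suc))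
  ... | no  a₀≢0 = mk⇔ (λ ()) (λ a≡0 → ⊥-elim (a₀≢0 (a≡0 zero)))

  ∑-𝟙-affine-degenerate : ∀ {a} → a ≡ F.0# → ∀ d t → ∑ (λ c → 𝟙 (c F.* a F.+ d == t)) ≡ q * 𝟙 (d == t)
  ∑-𝟙-affine-degenerate refl d t = trans (∑-cong (λ c → cong 𝟙 (==-⇔ c0+d≡t⇔d≡t))) (∑-const _)
    where
    c0+d≡t⇔d≡t : ∀ {c} → (c F.* F.0# F.+ d ≡ t) ⇔ (d ≡ t)
    c0+d≡t⇔d≡t {c} = let c0+d≡d = trans (cong (F._+ d) (F.zeroʳ c)) (F.+-identityˡ d) in
      mk⇔ (trans (sym c0+d≡d)) (trans c0+d≡d)

  ∑-𝟙-affine : ∀ {a} → a ≢ F.0# → ∀ d t → ∑ (λ c → 𝟙 (c F.* a F.+ d == t)) ≡ 1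
  ∑-𝟙-affine {a} a≢0 d t with inverse a a≢0
  ... | a⁻¹ , aa⁻¹≡1 = trans (∑-cong (λ c → cong 𝟙 (==-⇔ solve))) (∑-𝟙-== ((t F.- d) F.* a⁻¹))
    where
    *a*a⁻¹ : ∀ x → x F.* a F.* a⁻¹ ≡ x
    *a*a⁻¹ x = trans (F.*-assoc x a a⁻¹) (trans (cong (x F.*_) aa⁻¹≡1) (F.*-identityʳ x))
    *a⁻¹*a : ∀ x → x F.* a⁻¹ F.* a ≡ x
    *a⁻¹*a x = trans (F.*-assoc x a⁻¹ a) (trans (cong (x F.*_) (trans (F.*-comm a⁻¹ a) aa⁻¹≡1)) (F.*-identityʳ x))
    solve : ∀ {c} → (c F.* a F.+ d ≡ t) ⇔ ((t F.- d) F.* a⁻¹ ≡ c)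
    solve {c} = mk⇔
      (λ { refl → trans (cong (F._* a⁻¹) (x+y-y≡x (c F.* a) d)) (*a*a⁻¹ c) })
      (λ { refl → trans (cong (F._+ d) (*a⁻¹*a (t F.- d))) (x-y+y≡x t d) })

  ∑ᵛ-𝟙-dot : ∀ p (a : Vector Carrier p) t →
    q * ∑ᵛ p (λ c → 𝟙 (dot c a == t)) ≡ q ^ p * (if isZero a then q * 𝟙 (F.0# == t) else 1)
  ∑ᵛ-𝟙-dot zero    a t = sym (ℕ.*-identityˡ _)
  ∑ᵛ-𝟙-dot (suc p) a t with a zero ≟ F.0#
  ... | yes a₀≡0 = begin
    q * ∑ (λ c₀ → ∑ᵛ p (λ c → 𝟙 (c₀ F.* a zero F.+ dot c (a ∘ suc) == t)))
      ≡⟨ cong (q *_) (∑ᵛ-∑-comm p _) ⟨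
    q * ∑ᵛ p (λ c → ∑ (λ c₀ → 𝟙 (c₀ F.* a zero F.+ dot c (a ∘ suc) == t)))
      ≡⟨ cong (q *_) (∑ᵛ-cong p (λ c → ∑-𝟙-affine-degenerate a₀≡0 _ t)) ⟩
    q * ∑ᵛ p (λ c → q * 𝟙 (dot c (a ∘ suc) == t))
      ≡⟨ cong (q *_) (*-distribˡ-∑ᵛ p q _) ⟨
    q * (q * ∑ᵛ p (λ c → 𝟙 (dot c (a ∘ suc) == t)))
      ≡⟨ cong (q *_) (∑ᵛ-𝟙-dot p (a ∘ suc) t) ⟩
    q * (q ^ p * (if isZero (a ∘ suc) then q * 𝟙 (F.0# == t) else 1))
      ≡⟨ ℕ.*-assoc q (q ^ p) _ ⟨
    q ^ suc p * (if isZero (a ∘ suc) then q * 𝟙 (F.0# == t) else 1) ∎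
  ... | no a₀≢0 = begin
    q * ∑ (λ c₀ → ∑ᵛ p (λ c → 𝟙 (c₀ F.* a zero F.+ dot c (a ∘ suc) == t)))
      ≡⟨ cong (q *_) (∑ᵛ-∑-comm p _) ⟨
    q * ∑ᵛ p (λ c → ∑ (λ c₀ → 𝟙 (c₀ F.* a zero F.+ dot c (a ∘ suc) == t)))
      ≡⟨ cong (q *_) (∑ᵛ-cong p (λ c → ∑-𝟙-affine a₀≢0 _ t)) ⟩
    q * ∑ᵛ p (λ _ → 1)
      ≡⟨ cong (q *_) (∑ᵛ-const p 1) ⟩
    q * (q ^ p * 1)
      ≡⟨ ℕ.*-assoc q (q ^ p) 1 ⟨
    q ^ suc p * 1 ∎

module CodeIsometry (E : FieldExt) {n : ℕ} (B : Basis E n) where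

  open Ops E B hiding (_≗_; module K; module L)
  open FieldExt E using (ι; ι-+; ι-*; ι-1)
  open Basis B using (b; coords; expand; uniq)
  open FieldProperties (FieldExt.K E) hiding (module F)
  module Lₚ = FieldProperties (FieldExt.L E)

  module K where
    open FiniteField (FieldExt.K E) public using (_≟_; elements)
    open FieldProperties.F (FieldExt.K E) public

  module L = FieldProperties.F (FieldExt.L E)

  eqKVec-true : ∀ {p} {u v : KVec p} → eqKVec u v ≡ true → u ≗ v
  eqKVec-true {suc p} {u} {v} eq with u zero K.≟ v zero
  ... | yes u₀≡v₀ = λ { zero → u₀≡v₀ ; (suc j) → eqKVec-true eq j }

  eqKVec-≡ : ∀ {p} {u v u′ v′ : KVec p} → (∀ r → (u r ≡ v r) ⇔ (u′ r ≡ v′ r)) → eqKVec u v ≡ eqKVec u′ v′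
  eqKVec-≡ {zero}  _   = refl
  eqKVec-≡ {suc p} u⇔v = cong₂ _∧_ (==-⇔ (u⇔v zero)) (eqKVec-≡ (u⇔v ∘ suc))

  isZero≡eqKVec : ∀ {p} {a u v : KVec p} → (∀ r → (a r ≡ K.0#) ⇔ (u r ≡ v r)) → isZero a ≡ eqKVec u v
  isZero≡eqKVec {zero}  _   = refl
  isZero≡eqKVec {suc p} a⇔v = cong₂ _∧_ (==-⇔ (a⇔v zero)) (isZero≡eqKVec (a⇔v ∘ suc))

  eqKVec-cong : ∀ {p} {u u′ v v′ : KVec p} → u ≗ u′ → v ≗ v′ → eqKVec u v ≡ eqKVec u′ v′
  eqKVec-cong u≗u′ v≗v′ = eqKVec-≡ (λ r → ≡-⇔ (u≗u′ r) (v≗v′ r))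

  eqKVec-sym : ∀ {p} (u v : KVec p) → eqKVec u v ≡ eqKVec v u
  eqKVec-sym u v = eqKVec-≡ {u = u} {v} (λ r → mk⇔ sym sym)

  ∑ᵛ-δ : ∀ p (w : KVec p) (g : KVec p → ℕ) → Extensional g → ∑ᵛ p (λ x → 𝟙 (eqKVec w x) * g x) ≡ g w
  ∑ᵛ-δ zero    w g g-ext = trans (ℕ.+-identityʳ _) (g-ext (λ ()))
  ∑ᵛ-δ (suc p) w g g-ext = begin
    ∑ (λ a → ∑ᵛ p (λ v → 𝟙 ((w zero == a) ∧ eqKVec (w ∘ suc) v) * g (a ∷ᵛ v)))
      ≡⟨ ∑-cong (λ a → ∑ᵛ-cong p (λ v → 𝟙-∧ (w zero == a) _ _)) ⟩
    ∑ (λ a → ∑ᵛ p (λ v → 𝟙 (w zero == a) * (𝟙 (eqKVec (w ∘ suc) v) * g (a ∷ᵛ v))))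
      ≡⟨ ∑-cong (λ a → *-distribˡ-∑ᵛ p (𝟙 (w zero == a)) _) ⟨
    ∑ (λ a → 𝟙 (w zero == a) * ∑ᵛ p (λ v → 𝟙 (eqKVec (w ∘ suc) v) * g (a ∷ᵛ v)))
      ≡⟨ ∑-cong (λ a → cong (𝟙 (w zero == a) *_) (∑ᵛ-δ p (w ∘ suc) _ (∷ᵛ-extensional g-ext a))) ⟩
    ∑ (λ a → 𝟙 (w zero == a) * g (a ∷ᵛ (w ∘ suc)))
      ≡⟨ ∑-δ (w zero) _ ⟩
    g (w zero ∷ᵛ (w ∘ suc))
      ≡⟨ g-ext (λ { zero → refl ; (suc j) → refl }) ⟩
    g w ∎
    where
    𝟙-∧ : ∀ x y c → 𝟙 (x ∧ y) * c ≡ 𝟙 x * (𝟙 y * c)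
    𝟙-∧ true  y c = sym (ℕ.+-identityʳ _)
    𝟙-∧ false y c = refl

  sumOver-allVecs : ∀ p (g : KVec p → ℕ) → Extensional g → sumOver (allVecs p) g ≡ ∑ᵛ p g
  sumOver-allVecs zero    g g-ext = trans (ℕ.+-identityʳ _) (g-ext (λ ()))
  sumOver-allVecs (suc p) g g-ext = via-cons _ (λ a v → λ { zero → refl ; (suc j) → refl })
    where
    via-cons : (cons : KC → KVec p → KVec (suc p)) → (∀ a v → cons a v ≗ a ∷ᵛ v) →
      sumOver (concatMap (λ a → map (cons a) (allVecs p)) K.elements) g ≡ ∑ᵛ (suc p) g
    via-cons cons cons≗∷ = begin
      sumOver (concatMap (λ a → map (cons a) (allVecs p)) K.elements) g
        ≡⟨ sumOver-concatMap _ K.elements g ⟩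
      ∑ (λ a → sumOver (map (cons a) (allVecs p)) g)
        ≡⟨ ∑-cong (λ a → sumOver-map (cons a) (allVecs p) g) ⟩
      ∑ (λ a → sumOver (allVecs p) (g ∘ cons a))
        ≡⟨ ∑-cong (λ a → sumOver-allVecs p (g ∘ cons a) (g-ext ∘ cons-cong a)) ⟩
      ∑ (λ a → ∑ᵛ p (g ∘ cons a))
        ≡⟨ ∑-cong (λ a → ∑ᵛ-cong p (λ v → g-ext (cons≗∷ a v))) ⟩
      ∑ᵛ (suc p) g ∎
      where
      cons-cong : ∀ a {u v} → u ≗ v → cons a u ≗ cons a v
      cons-cong a {u} {v} u≗v r = trans (cons≗∷ a u r) (trans (∷ᵛ-cong a u≗v r) (sym (cons≗∷ a v r)))
        where
        ∷ᵛ-cong : ∀ a {u v : KVec p} → u ≗ v → (a ∷ᵛ u) ≗ (a ∷ᵛ v)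
        ∷ᵛ-cong a u≗v zero    = refl
        ∷ᵛ-cong a u≗v (suc j) = u≗v j

  -- Fibres of the column maps

  module Column {k m} (M : Mat k m) (i : Fin m) where

    φ : KVec n → KVec k
    φ = colComb M i

    fibre : KVec k → ℕ
    fibre w = ∑ᵛ n (λ c → 𝟙 (eqKVec w (φ c)))

    φ-cong : ∀ {c d} → c ≗ d → φ c ≗ φ d
    φ-cong c≗d r = ∑F-cong (λ j → cong (K._* colVec M i j r) (c≗d j))

    φ-+ : ∀ c d → φ (c +ᵛ d) ≗ φ c +ᵛ φ d
    φ-+ c d r = trans (∑F-cong (λ j → K.distribʳ (colVec M i j r) (c j) (d j)))
                      (∑F-distrib-+ (λ j → c j K.* colVec M i j r) (λ j → d j K.* colVec M i j r))

    inColSpace-cong : Extensional (inColSpace M i)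
    inColSpace-cong u≗v = any-cong (λ c → eqKVec-cong u≗v (λ _ → refl)) (allVecs n)
      where
      any-cong : ∀ {A : Set} {P Q : A → Bool} → (∀ a → P a ≡ Q a) → ∀ xs → any P xs ≡ any Q xs
      any-cong P≗Q []       = refl
      any-cong P≗Q (x ∷ xs) = cong₂ _∨_ (P≗Q x) (any-cong P≗Q xs)

    fibre-summand-cong : ∀ w → Extensional (λ c → 𝟙 (eqKVec w (φ c)))
    fibre-summand-cong w c≗d = cong 𝟙 (eqKVec-cong (λ _ → refl) (φ-cong c≗d))

    fibre≡ : ∀ w → fibre w ≡ 𝟙 (inColSpace M i w) * fibre (λ _ → K.0#)
    fibre≡ w with inColSpace M i w in w∈?
    ... | false = trans (sym (sumOver-allVecs n _ (fibre-summand-cong w))) (sumOver-𝟙-¬any _ (allVecs n) w∈?)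
    ... | true  with satisfied (any⁻ _ (allVecs n) (Equivalence.from T-≡ w∈?))
    ... | c₀ , w≡φc₀ = begin
      fibre w                                      ≡⟨ ∑ᵛ-translate n _ (fibre-summand-cong w) c₀ ⟨
      ∑ᵛ n (λ c → 𝟙 (eqKVec w (φ (c +ᵛ c₀))))      ≡⟨ ∑ᵛ-cong n (λ c → cong 𝟙 (fibre-summand-shift c)) ⟩
      fibre (λ _ → K.0#)                           ≡⟨ ℕ.+-identityʳ _ ⟨
      1 * fibre (λ _ → K.0#)                       ∎
      where
      w≗φc₀ : w ≗ φ c₀
      w≗φc₀ = eqKVec-true (Equivalence.to T-≡ w≡φc₀)
      fibre-summand-shift : ∀ c → eqKVec w (φ (c +ᵛ c₀)) ≡ eqKVec (λ _ → K.0#) (φ c)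
      fibre-summand-shift c =
        eqKVec-≡ (λ r → ⇔.trans (≡-⇔ (w≗φc₀ r) (φ-+ c c₀ r)) (x≡y+x⇔0≡y (φ c₀ r) (φ c r)))

    ∑ᵛ-fibre-weighted : ∀ (g : KVec k → ℕ) → Extensional g → ∑ᵛ k (λ x → fibre x * g x) ≡ ∑ᵛ n (g ∘ φ)
    ∑ᵛ-fibre-weighted g g-ext = begin
      ∑ᵛ k (λ x → fibre x * g x)                              ≡⟨ ∑ᵛ-cong k expand-fibre ⟩
      ∑ᵛ k (λ x → ∑ᵛ n (λ c → 𝟙 (eqKVec (φ c) x) * g x))      ≡⟨ ∑ᵛ-comm k n _ ⟩
      ∑ᵛ n (λ c → ∑ᵛ k (λ x → 𝟙 (eqKVec (φ c) x) * g x))      ≡⟨ ∑ᵛ-cong n (λ c → ∑ᵛ-δ k (φ c) g g-ext) ⟩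
      ∑ᵛ n (g ∘ φ)                                            ∎
      where
      expand-fibre : ∀ x → fibre x * g x ≡ ∑ᵛ n (λ c → 𝟙 (eqKVec (φ c) x) * g x)
      expand-fibre x = begin
        fibre x * g x
          ≡⟨ ℕ.*-comm (fibre x) (g x) ⟩
        g x * fibre x
          ≡⟨ *-distribˡ-∑ᵛ n (g x) _ ⟩
        ∑ᵛ n (λ c → g x * 𝟙 (eqKVec x (φ c)))
          ≡⟨ ∑ᵛ-cong n (λ c → trans (ℕ.*-comm (g x) _) (cong (λ b → 𝟙 b * g x) (eqKVec-sym x (φ c)))) ⟩
        ∑ᵛ n (λ c → 𝟙 (eqKVec (φ c) x) * g x) ∎

    ∑ᵛ-fibre : ∑ᵛ k fibre ≡ q ^ n
    ∑ᵛ-fibre = begin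
      ∑ᵛ k fibre                    ≡⟨ ∑ᵛ-cong k (λ x → sym (ℕ.*-identityʳ (fibre x))) ⟩
      ∑ᵛ k (λ x → fibre x * 1)      ≡⟨ ∑ᵛ-fibre-weighted (λ _ → 1) (λ _ → refl) ⟩
      ∑ᵛ n (λ _ → 1)                ≡⟨ trans (∑ᵛ-const n 1) (ℕ.*-identityʳ _) ⟩
      q ^ n                         ∎

    card≡∑ᵛ : card M i ≡ ∑ᵛ k (𝟙 ∘ inColSpace M i)
    card≡∑ᵛ = trans (length-filterᵇ (inColSpace M i) (allVecs k)) (sumOver-allVecs k _ (cong 𝟙 ∘ inColSpace-cong))

    card*fibre : ∀ w → card M i * fibre w ≡ 𝟙 (inColSpace M i w) * q ^ n
    card*fibre w = begin
      card M i * fibre w                        ≡⟨ cong (card M i *_) (fibre≡ w) ⟩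
      card M i * (𝟙 (inColSpace M i w) * κ)     ≡⟨ x*yz≡y*xz (card M i) (𝟙 (inColSpace M i w)) κ ⟩
      𝟙 (inColSpace M i w) * (card M i * κ)     ≡⟨ cong (𝟙 (inColSpace M i w) *_) card*κ ⟩
      𝟙 (inColSpace M i w) * q ^ n              ∎
      where
      κ = fibre (λ _ → K.0#)
      card*κ : card M i * κ ≡ q ^ n
      card*κ = begin
        card M i * κ
          ≡⟨ cong (_* κ) card≡∑ᵛ ⟩
        ∑ᵛ k (𝟙 ∘ inColSpace M i) * κ
          ≡⟨ ℕ.*-comm _ κ ⟩
        κ * ∑ᵛ k (𝟙 ∘ inColSpace M i)
          ≡⟨ *-distribˡ-∑ᵛ k κ _ ⟩
        ∑ᵛ k (λ x → κ * 𝟙 (inColSpace M i x))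
          ≡⟨ ∑ᵛ-cong k (λ x → trans (ℕ.*-comm κ _) (sym (fibre≡ x))) ⟩
        ∑ᵛ k fibre
          ≡⟨ ∑ᵛ-fibre ⟩
        q ^ n ∎

    coef : KVec k → KVec n
    coef u j = dot u (colVec M i j)

    perp : KVec k → Bool
    perp u = isZero (coef u)

    dot-φ : ∀ u c → dot u (φ c) ≡ dot c (coef u)
    dot-φ u c = begin
      ∑F (λ r → u r K.* ∑F (λ j → c j K.* colVec M i j r))
        ≡⟨ ∑F-cong (λ r → *-distribˡ-∑F (u r) (λ j → c j K.* colVec M i j r)) ⟩
      ∑F (λ r → ∑F (λ j → u r K.* (c j K.* colVec M i j r)))
        ≡⟨ ∑F-comm (λ r j → u r K.* (c j K.* colVec M i j r)) ⟩
      ∑F (λ j → ∑F (λ r → u r K.* (c j K.* colVec M i j r)))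
        ≡⟨ ∑F-cong (λ j → ∑F-cong (λ r → K.x*yz≡y*xz (u r) (c j) _)) ⟩
      ∑F (λ j → ∑F (λ r → c j K.* (u r K.* colVec M i j r)))
        ≡⟨ ∑F-cong (λ j → *-distribˡ-∑F (c j) (λ r → u r K.* colVec M i j r)) ⟨
      ∑F (λ j → c j K.* dot u (colVec M i j)) ∎

    -- Both sides count the pairs (u , c) with u · φ c = u · x, up to the factor q.
    duality-fibre : ∀ x → q ^ k * ∑ᵛ n (λ c → if eqKVec x (φ c) then q else 1)
                        ≡ q ^ n * ∑ᵛ k (λ u → if perp u then q * 𝟙 (K.0# == dot u x) else 1)
    duality-fibre x = begin
      q ^ k * ∑ᵛ n (λ c → if eqKVec x (φ c) then q else 1)
        ≡⟨ *-distribˡ-∑ᵛ n (q ^ k) _ ⟩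
      ∑ᵛ n (λ c → q ^ k * (if eqKVec x (φ c) then q else 1))
        ≡⟨ ∑ᵛ-cong n count-u ⟨
      ∑ᵛ n (λ c → q * ∑ᵛ k (λ u → 𝟙 (dot c (coef u) == dot u x)))
        ≡⟨ *-distribˡ-∑ᵛ n q _ ⟨
      q * ∑ᵛ n (λ c → ∑ᵛ k (λ u → 𝟙 (dot c (coef u) == dot u x)))
        ≡⟨ cong (q *_) (∑ᵛ-comm n k _) ⟩
      q * ∑ᵛ k (λ u → ∑ᵛ n (λ c → 𝟙 (dot c (coef u) == dot u x)))
        ≡⟨ *-distribˡ-∑ᵛ k q _ ⟩
      ∑ᵛ k (λ u → q * ∑ᵛ n (λ c → 𝟙 (dot c (coef u) == dot u x)))
        ≡⟨ ∑ᵛ-cong k (λ u → ∑ᵛ-𝟙-dot n (coef u) (dot u x)) ⟩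
      ∑ᵛ k (λ u → q ^ n * (if perp u then q * 𝟙 (K.0# == dot u x) else 1))
        ≡⟨ *-distribˡ-∑ᵛ k (q ^ n) _ ⟨
      q ^ n * ∑ᵛ k (λ u → if perp u then q * 𝟙 (K.0# == dot u x) else 1) ∎
      where
      isZero[φc-x]≡ : ∀ c → isZero (φ c -ᵛ x) ≡ eqKVec x (φ c)
      isZero[φc-x]≡ c = isZero≡eqKVec (λ r → ⇔.trans (x-y≡0⇔x≡y (φ c r) (x r)) (mk⇔ sym sym))
      count-u : ∀ c → q * ∑ᵛ k (λ u → 𝟙 (dot c (coef u) == dot u x)) ≡ q ^ k * (if eqKVec x (φ c) then q else 1)
      count-u c = begin
        q * ∑ᵛ k (λ u → 𝟙 (dot c (coef u) == dot u x))
          ≡⟨ cong (q *_) (∑ᵛ-cong k (λ u → cong 𝟙 (==-⇔ (shift u)))) ⟩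
        q * ∑ᵛ k (λ u → 𝟙 (dot u (φ c -ᵛ x) == K.0#))
          ≡⟨ ∑ᵛ-𝟙-dot k (φ c -ᵛ x) K.0# ⟩
        q ^ k * (if isZero (φ c -ᵛ x) then q * 𝟙 (K.0# == K.0#) else 1)
          ≡⟨ cong (q ^ k *_) (cong₂ (λ b z → if b then z else 1) (isZero[φc-x]≡ c) q*𝟙[0==0]≡q) ⟩
        q ^ k * (if eqKVec x (φ c) then q else 1) ∎
        where
        shift : ∀ u → (dot c (coef u) ≡ dot u x) ⇔ (dot u (φ c -ᵛ x) ≡ K.0#)
        shift u = mk⇔
          (λ eq → trans (dot-distrib-- u (φ c) x) (Equivalence.from (x-y≡0⇔x≡y _ _) (trans (dot-φ u c) eq)))
          (λ eq → trans (sym (dot-φ u c)) (Equivalence.to (x-y≡0⇔x≡y _ _) (trans (sym (dot-distrib-- u (φ c) x)) eq)))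

    duality-perp : ∀ u → q * ∑ᵛ k (λ x → fibre x * 𝟙 (dot u x == K.0#)) ≡ q ^ n * (if perp u then q else 1)
    duality-perp u = begin
      q * ∑ᵛ k (λ x → fibre x * 𝟙 (dot u x == K.0#))
        ≡⟨ cong (q *_) (∑ᵛ-fibre-weighted _ (λ x≗y → cong (λ z → 𝟙 (z == K.0#)) (dot-congʳ u x≗y))) ⟩
      q * ∑ᵛ n (λ c → 𝟙 (dot u (φ c) == K.0#))
        ≡⟨ cong (q *_) (∑ᵛ-cong n (λ c → cong (λ z → 𝟙 (z == K.0#)) (dot-φ u c))) ⟩
      q * ∑ᵛ n (λ c → 𝟙 (dot c (coef u) == K.0#))
        ≡⟨ ∑ᵛ-𝟙-dot n (coef u) K.0# ⟩
      q ^ n * (if perp u then q * 𝟙 (K.0# == K.0#) else 1)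
        ≡⟨ cong (λ z → q ^ n * (if perp u then z else 1)) q*𝟙[0==0]≡q ⟩
      q ^ n * (if perp u then q else 1) ∎

  -- Duality between fibre counts and orthogonal columns

  perpCount : ∀ {k m} → Mat k m → KVec k → ℕ
  perpCount M u = sum (λ i → 𝟙 (Column.perp M i u))

  fibreSum : ∀ {k m} → Mat k m → KVec k → ℕ
  fibreSum M x = sum (λ i → Column.fibre M i x)

  module _ {k m} (M : Mat k m) where
    open Column M

    fibreSum-duality : ∀ x →
      q ^ k * (m * q ^ n + pred q * fibreSum M x)
        ≡ q ^ n * ∑ᵛ k (λ u → sum (λ i → if perp i u then q * 𝟙 (K.0# == dot u x) else 1))
    fibreSum-duality x = begin
      q ^ k * (m * q ^ n + pred q * fibreSum M x)
        ≡⟨ cong (q ^ k *_) column-sums ⟨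
      q ^ k * sum (λ i → ∑ᵛ n (λ c → if eqKVec x (φ i c) then q else 1))
        ≡⟨ *-distribˡ-sum {m} (q ^ k) _ ⟩
      sum (λ i → q ^ k * ∑ᵛ n (λ c → if eqKVec x (φ i c) then q else 1))
        ≡⟨ sum-cong-≗ (λ i → duality-fibre i x) ⟩
      sum (λ i → q ^ n * ∑ᵛ k (λ u → if perp i u then y u else 1))
        ≡⟨ *-distribˡ-sum {m} (q ^ n) _ ⟨
      q ^ n * sum (λ i → ∑ᵛ k (λ u → if perp i u then y u else 1))
        ≡⟨ cong (q ^ n *_) (sum-∑ᵛ-comm {m} k _) ⟩
      q ^ n * ∑ᵛ k (λ u → sum (λ i → if perp i u then y u else 1)) ∎
      where
      y : KVec k → ℕ
      y u = q * 𝟙 (K.0# == dot u x)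
      column-sums : sum (λ i → ∑ᵛ n (λ c → if eqKVec x (φ i c) then q else 1)) ≡ m * q ^ n + pred q * fibreSum M x
      column-sums = begin
        sum (λ i → ∑ᵛ n (λ c → if eqKVec x (φ i c) then q else 1))
          ≡⟨ sum-cong-≗ (λ i → ∑ᵛ-if-q n (λ c → eqKVec x (φ i c))) ⟩
        sum (λ i → q ^ n + pred q * fibre i x)
          ≡⟨ ∑-distrib-+ {m} (λ _ → q ^ n) _ ⟩
        sum {m} (λ _ → q ^ n) + sum (λ i → pred q * fibre i x)
          ≡⟨ cong₂ _+_ (sum-const m (q ^ n)) (sym (*-distribˡ-sum {m} (pred q) _)) ⟩
        m * q ^ n + pred q * fibreSum M x ∎

    perpCount-duality : ∀ u →
      q * ∑ᵛ k (λ x → fibreSum M x * 𝟙 (dot u x == K.0#)) ≡ q ^ n * (m + pred q * perpCount M u)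
    perpCount-duality u = begin
      q * ∑ᵛ k (λ x → fibreSum M x * g x)
        ≡⟨ cong (q *_) (∑ᵛ-cong k (λ x → *-distribʳ-sum {m} (g x) _)) ⟩
      q * ∑ᵛ k (λ x → sum (λ i → fibre i x * g x))
        ≡⟨ cong (q *_) (sum-∑ᵛ-comm {m} k _) ⟨
      q * sum (λ i → ∑ᵛ k (λ x → fibre i x * g x))
        ≡⟨ *-distribˡ-sum {m} q (λ i → ∑ᵛ k (λ x → fibre i x * g x)) ⟩
      sum (λ i → q * ∑ᵛ k (λ x → fibre i x * g x))
        ≡⟨ sum-cong-≗ (λ i → duality-perp i u) ⟩
      sum (λ i → q ^ n * (if perp i u then q else 1))
        ≡⟨ *-distribˡ-sum {m} (q ^ n) _ ⟨
      q ^ n * sum (λ i → if perp i u then q else 1)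
        ≡⟨ cong (q ^ n *_) (sum-if-q (λ i → perp i u)) ⟩
      q ^ n * (m + pred q * perpCount M u) ∎
      where
      g : KVec k → ℕ
      g x = 𝟙 (dot u x == K.0#)

  module _ {k m} (A A′ : Mat k m) where

    perpCount⇒fibreSum : (∀ u → perpCount A u ≡ perpCount A′ u) → ∀ x → fibreSum A x ≡ fibreSum A′ x
    perpCount⇒fibreSum N≡N′ x =
      ℕ.*-cancelˡ-≡ _ _ (pred q) (ℕ.+-cancelˡ-≡ (m * q ^ n) _ _ (ℕ.*-cancelˡ-≡ _ _ (q ^ k) {{ℕ.m^n≢0 q k}} (begin
        q ^ k * (m * q ^ n + pred q * fibreSum A x)   ≡⟨ fibreSum-duality A x ⟩
        q ^ n * ∑ᵛ k (S A)                            ≡⟨ cong (q ^ n *_) (∑ᵛ-cong k S≡S′) ⟩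
        q ^ n * ∑ᵛ k (S A′)                           ≡⟨ fibreSum-duality A′ x ⟨
        q ^ k * (m * q ^ n + pred q * fibreSum A′ x)  ∎)))
      where
      y : KVec k → ℕ
      y u = q * 𝟙 (K.0# == dot u x)
      S : Mat k m → KVec k → ℕ
      S M u = sum (λ i → if Column.perp M i u then y u else 1)
      S≡S′ : ∀ u → S A u ≡ S A′ u
      S≡S′ u = ℕ.+-cancelʳ-≡ (perpCount A u) _ _ (begin
        S A u + perpCount A u      ≡⟨ sum-if-then-else-1 (λ i → Column.perp A i u) (y u) ⟩
        m + perpCount A u * y u    ≡⟨ cong (λ N → m + N * y u) (N≡N′ u) ⟩
        m + perpCount A′ u * y u   ≡⟨ sum-if-then-else-1 (λ i → Column.perp A′ i u) (y u) ⟨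
        S A′ u + perpCount A′ u    ≡⟨ cong (S A′ u +_) (N≡N′ u) ⟨
        S A′ u + perpCount A u     ∎)

    fibreSum⇒perpCount : (∀ x → fibreSum A x ≡ fibreSum A′ x) → ∀ u → perpCount A u ≡ perpCount A′ u
    fibreSum⇒perpCount F≡F′ u =
      ℕ.*-cancelˡ-≡ _ _ (pred q) (ℕ.+-cancelˡ-≡ m _ _ (ℕ.*-cancelˡ-≡ _ _ (q ^ n) {{ℕ.m^n≢0 q n}} (begin
        q ^ n * (m + pred q * perpCount A u)
          ≡⟨ perpCount-duality A u ⟨
        q * ∑ᵛ k (λ x → fibreSum A x * 𝟙 (dot u x == K.0#))
          ≡⟨ cong (q *_) (∑ᵛ-cong k (λ x → cong (_* 𝟙 (dot u x == K.0#)) (F≡F′ x))) ⟩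
        q * ∑ᵛ k (λ x → fibreSum A′ x * 𝟙 (dot u x == K.0#))
          ≡⟨ perpCount-duality A′ u ⟩
        q ^ n * (m + pred q * perpCount A′ u) ∎)))

  -- Coordinates and Hamming weights

  ι-0 : ι K.0# ≡ L.0#
  ι-0 = L.x+x≈x⇒x≈0 (ι K.0#) (trans (sym (ι-+ K.0# K.0#)) (cong ι (K.+-identityˡ K.0#)))

  ι-- : ∀ a c → ι (a K.- c) ≡ ι a L.- ι c
  ι-- a c = trans (ι-+ a (K.- c)) (cong (ι a L.+_) ι-neg)
    where
    ι-neg : ι (K.- c) ≡ L.- ι c
    ι-neg = L.inverseʳ-unique (ι c) (ι (K.- c)) (trans (sym (ι-+ c (K.- c))) (trans (cong ι (K.-‿inverseʳ c)) ι-0))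

  coords-+ : ∀ x y j → coords (x L.+ y) j ≡ coords x j K.+ coords y j
  coords-+ x y = uniq (x L.+ y) (λ j → coords x j K.+ coords y j) (begin
    x L.+ y
      ≡⟨ cong₂ L._+_ (expand x) (expand y) ⟩
    Lₚ.∑F (λ j → ι (coords x j) L.* b j) L.+ Lₚ.∑F (λ j → ι (coords y j) L.* b j)
      ≡⟨ Lₚ.∑F-distrib-+ {n} _ _ ⟨
    Lₚ.∑F (λ j → ι (coords x j) L.* b j L.+ ι (coords y j) L.* b j)
      ≡⟨ Lₚ.∑F-cong (λ j → trans (sym (L.distribʳ (b j) _ _)) (cong (L._* b j) (sym (ι-+ _ _)))) ⟩
    Lₚ.∑F (λ j → ι (coords x j K.+ coords y j) L.* b j) ∎)

  coords-ι* : ∀ a x j → coords (ι a L.* x) j ≡ a K.* coords x j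
  coords-ι* a x = uniq (ι a L.* x) (λ j → a K.* coords x j) (begin
    ι a L.* x
      ≡⟨ cong (ι a L.*_) (expand x) ⟩
    ι a L.* Lₚ.∑F (λ j → ι (coords x j) L.* b j)
      ≡⟨ Lₚ.*-distribˡ-∑F {n} (ι a) _ ⟩
    Lₚ.∑F (λ j → ι a L.* (ι (coords x j) L.* b j))
      ≡⟨ Lₚ.∑F-cong (λ j → trans (sym (L.*-assoc (ι a) _ (b j))) (cong (L._* b j) (sym (ι-* a _)))) ⟩
    Lₚ.∑F (λ j → ι (a K.* coords x j) L.* b j) ∎)

  0≡∑ι0*b : L.0# ≡ Lₚ.∑F (λ j → ι K.0# L.* b j)
  0≡∑ι0*b = sym (trans (Lₚ.∑F-cong (λ j → trans (cong (L._* b j) ι-0) (L.zeroˡ (b j)))) (Lₚ.∑F-zero n))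

  coords-0 : ∀ j → coords L.0# j ≡ K.0#
  coords-0 = uniq L.0# (λ _ → K.0#) 0≡∑ι0*b

  coords≡0⇒≡0 : ∀ l → (∀ j → coords l j ≡ K.0#) → l ≡ L.0#
  coords≡0⇒≡0 l coords≡0 =
    trans (expand l) (trans (Lₚ.∑F-cong (λ j → cong (λ a → ι a L.* b j) (coords≡0 j))) (sym 0≡∑ι0*b))

  coords-∑F : ∀ {p} (f : Fin p → LC) j → coords (Lₚ.∑F f) j ≡ ∑F (λ r → coords (f r) j)
  coords-∑F {zero}  f j = coords-0 j
  coords-∑F {suc p} f j = trans (coords-+ (f zero) _ j) (cong (coords (f zero) j K.+_) (coords-∑F (f ∘ suc) j))

  coords-linMap : ∀ {k m} (M : Mat k m) u i j → coords (linMap M u i) j ≡ Column.coef M i u j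
  coords-linMap M u i j = trans (coords-∑F (λ r → ι (u r) L.* M r i) j) (∑F-cong (λ r → coords-ι* (u r) (M r i) j))

  linMap-==0 : ∀ {k m} (M : Mat k m) u i → (linMap M u i Lₚ.== L.0#) ≡ Column.perp M i u
  linMap-==0 M u i = true-⇔⇒≡ (mk⇔
    (λ eq → Equivalence.from (isZero-⇔ _) (λ j → trans (sym (coords-linMap M u i j))
              (trans (cong (λ l → coords l j) (Equivalence.to Lₚ.==≡true⇔≡ eq)) (coords-0 j))))
    (λ eq → Equivalence.from Lₚ.==≡true⇔≡ (coords≡0⇒≡0 _ (λ j →
              trans (coords-linMap M u i j) (Equivalence.to (isZero-⇔ _) eq j)))))

  hamming≡sum : ∀ {m} (x y : LVec m) → hamming x y ≡ sum (λ i → if x i Lₚ.== y i then 0 else 1)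
  hamming≡sum {zero}  x y = refl
  hamming≡sum {suc m} x y = cong ((if x zero Lₚ.== y zero then 0 else 1) +_) (hamming≡sum (x ∘ suc) (y ∘ suc))

  hamming-cong-== : ∀ {m} {x y x′ y′ : LVec m} → (∀ i → (x i Lₚ.== y i) ≡ (x′ i Lₚ.== y′ i)) →
    hamming x y ≡ hamming x′ y′
  hamming-cong-== {x = x} {y} {x′} {y′} eq = begin
    hamming x y
      ≡⟨ hamming≡sum x y ⟩
    sum (λ i → if x i Lₚ.== y i then 0 else 1)
      ≡⟨ sum-cong-≗ (λ i → cong (λ c → if c then 0 else 1) (eq i)) ⟩
    sum (λ i → if x′ i Lₚ.== y′ i then 0 else 1)
      ≡⟨ hamming≡sum x′ y′ ⟨
    hamming x′ y′ ∎

  hamming-cong : ∀ {m} {x y x′ y′ : LVec m} → x ≗ x′ → y ≗ y′ → hamming x y ≡ hamming x′ y′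
  hamming-cong x≗x′ y≗y′ = hamming-cong-== (λ i → cong₂ Lₚ._==_ (x≗x′ i) (y≗y′ i))

  weight : ∀ {k m} → Mat k m → KVec k → ℕ
  weight M u = hamming (linMap M u) zeroL

  weight+perpCount : ∀ {k m} (M : Mat k m) u → weight M u + perpCount M u ≡ m
  weight+perpCount {m = m} M u = begin
    weight M u + perpCount M u
      ≡⟨ cong (_+ perpCount M u) (hamming≡sum (linMap M u) zeroL) ⟩
    sum (λ i → if linMap M u i Lₚ.== L.0# then 0 else 1) + perpCount M u
      ≡⟨ ∑-distrib-+ {m} _ _ ⟨
    sum (λ i → (if linMap M u i Lₚ.== L.0# then 0 else 1) + 𝟙 (Column.perp M i u))
      ≡⟨ sum-cong-≗ pointwise ⟩
    sum {m} (λ _ → 1)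
      ≡⟨ trans (sum-const m 1) (ℕ.*-identityʳ m) ⟩
    m ∎
    where
    pointwise : ∀ i → (if linMap M u i Lₚ.== L.0# then 0 else 1) + 𝟙 (Column.perp M i u) ≡ 1
    pointwise i rewrite linMap-==0 M u i with Column.perp M i u
    ... | true  = refl
    ... | false = refl

  linMap-- : ∀ {k m} (M : Mat k m) u u′ i → linMap M u i L.- linMap M u′ i ≡ linMap M (u -ᵛ u′) i
  linMap-- {k} M u u′ i = begin
    Lₚ.∑F (λ r → ι (u r) L.* M r i) L.- Lₚ.∑F (λ r → ι (u′ r) L.* M r i)
      ≡⟨ Lₚ.∑F-distrib-- {k} _ _ ⟨
    Lₚ.∑F (λ r → ι (u r) L.* M r i L.- ι (u′ r) L.* M r i)
      ≡⟨ Lₚ.∑F-cong (λ r → sym (L.[y-z]x≈yx-zx (M r i) (ι (u r)) (ι (u′ r)))) ⟩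
    Lₚ.∑F (λ r → (ι (u r) L.- ι (u′ r)) L.* M r i)
      ≡⟨ Lₚ.∑F-cong (λ r → cong (L._* M r i) (ι-- (u r) (u′ r))) ⟨
    Lₚ.∑F (λ r → ι (u r K.- u′ r) L.* M r i) ∎

  hamming-linMap : ∀ {k m} (M : Mat k m) u u′ → hamming (linMap M u) (linMap M u′) ≡ weight M (u -ᵛ u′)
  hamming-linMap M u u′ = hamming-cong-== (λ i → trans
    (Lₚ.==-⇔ (⇔.sym (Lₚ.x-y≡0⇔x≡y (linMap M u i) (linMap M u′ i))))
    (cong (Lₚ._== L.0#) (linMap-- M u u′ i)))

  linMap-0 : ∀ {k m} (M : Mat k m) → linMap M (λ _ → K.0#) ≗ zeroL
  linMap-0 {k} M i = trans (Lₚ.∑F-cong (λ r → trans (cong (L._* M r i) ι-0) (L.zeroˡ (M r i)))) (Lₚ.∑F-zero k)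

  open FixedDenominator (pred (q ^ n))

  inv≡frac : ∀ c h → c * h ≡ q ^ n → inv c ≡ frac h
  inv≡frac zero    h 0≡qⁿ = ⊥-elim (≢-nonZero⁻¹ (q ^ n) {{ℕ.m^n≢0 q n}} (sym 0≡qⁿ))
  inv≡frac (suc c) h eq   = 1/-frac c h (trans eq (sym (ℕ.suc-pred (q ^ n) {{ℕ.m^n≢0 q n}})))

  weightFun≡frac : ∀ {k m} (M : Mat k m) x → weightFun M x ≡ frac (fibreSum M x)
  weightFun≡frac M x = sumℚ≡frac (λ i → columnTerm≡frac i)
    where
    columnTerm≡frac : ∀ i → (if inColSpace M i x then inv (card M i) else 0ℚ) ≡ frac (Column.fibre M i x)
    columnTerm≡frac i with inColSpace M i x | Column.card*fibre M i x | Column.fibre≡ M i x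
    ... | false | _           | fibre≡0 = trans (sym frac-0) (cong frac (sym fibre≡0))
    ... | true  | card*fibre≡ | _       = inv≡frac (card M i) _ (trans card*fibre≡ (ℕ.+-identityʳ _))
    sumℚ≡frac : ∀ {m} {t : Fin m → ℚ} {h : Fin m → ℕ} → (∀ i → t i ≡ frac (h i)) → sumℚ t ≡ frac (sum h)
    sumℚ≡frac {zero}  _  = sym frac-0
    sumℚ≡frac {suc m} {h = h} t≡h =
      trans (cong₂ ℚ._+_ (t≡h zero) (sumℚ≡frac (t≡h ∘ suc))) (frac-+ (h zero) (sum (h ∘ suc)))

  module _ {k m} (C : LVec m → Set) (A A′ : Mat k m) (f : Sub C → LVec m) where

    isometry⇔weight-preserving : IsGeneratorMatrix C A → IsKLinear C f → Represents C f A A′ →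
      IsIsometry C f ⇔ (∀ u → weight A′ u ≡ weight A u)
    isometry⇔weight-preserving (C≡λU , _) f-linear f-rep = mk⇔ to from
      where
      λu∈C : ∀ u → C (linMap A u)
      λu∈C u = Equivalence.from (C≡λU (linMap A u)) (u , λ _ → refl)

      ι1*v+ι0*v≡v : ∀ v → ι K.1# L.* v L.+ ι K.0# L.* v ≡ v
      ι1*v+ι0*v≡v v = trans (cong₂ L._+_ (trans (cong (L._* v) ι-1) (L.*-identityˡ v))
                                          (trans (cong (L._* v) ι-0) (L.zeroˡ v)))
                            (L.+-identityʳ v)

      f-cong : ∀ (x y : Sub C) → proj₁ x ≗ proj₁ y → f x ≗ f y
      f-cong x y x≗y i = trans (f-linear y y x K.1# K.0# (λ j → trans (x≗y j) (sym (ι1*v+ι0*v≡v (proj₁ y j)))) i)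
                               (ι1*v+ι0*v≡v (f y i))

      to : IsIsometry C f → ∀ u → weight A′ u ≡ weight A u
      to isometry u = begin
        hamming (linMap A′ u) zeroL
          ≡⟨ hamming-cong (sym ∘ f-rep u (λu∈C u)) (λ i → sym (trans (f-rep _ (λu∈C _) i) (linMap-0 A′ i))) ⟩
        hamming (f (linMap A u , _)) (f (linMap A (λ _ → K.0#) , _))
          ≡⟨ isometry _ _ ⟩
        hamming (linMap A u) (linMap A (λ _ → K.0#))
          ≡⟨ hamming-cong (λ _ → refl) (linMap-0 A) ⟩
        hamming (linMap A u) zeroL ∎

      from : (∀ u → weight A′ u ≡ weight A u) → IsIsometry C f
      from weight≡ x y with Equivalence.to (C≡λU (proj₁ x)) (proj₂ x) | Equivalence.to (C≡λU (proj₁ y)) (proj₂ y)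
      ... | u , λu≗x | u′ , λu′≗y = begin
        hamming (f x) (f y)
          ≡⟨ hamming-cong (f-cong x (_ , λu∈C u) (sym ∘ λu≗x)) (f-cong y (_ , λu∈C u′) (sym ∘ λu′≗y)) ⟩
        hamming (f (linMap A u , _)) (f (linMap A u′ , _))
          ≡⟨ hamming-cong (f-rep u (λu∈C u)) (f-rep u′ (λu∈C u′)) ⟩
        hamming (linMap A′ u) (linMap A′ u′)
          ≡⟨ hamming-linMap A′ u u′ ⟩
        weight A′ (u -ᵛ u′)
          ≡⟨ weight≡ (u -ᵛ u′) ⟩
        weight A (u -ᵛ u′)
          ≡⟨ hamming-linMap A u u′ ⟨
        hamming (linMap A u) (linMap A u′)
          ≡⟨ hamming-cong λu≗x λu′≗y ⟩
        hamming (proj₁ x) (proj₁ y) ∎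

  module _ {k m} (A A′ : Mat k m) where

    weight-preserving⇔perpCount : (∀ u → weight A′ u ≡ weight A u) ⇔ (∀ u → perpCount A u ≡ perpCount A′ u)
    weight-preserving⇔perpCount = mk⇔
      (λ w≡ u → ℕ.+-cancelˡ-≡ (weight A u) _ _ (trans (weight+perpCount A u)
                  (trans (sym (weight+perpCount A′ u)) (cong (_+ perpCount A′ u) (w≡ u)))))
      (λ N≡ u → ℕ.+-cancelʳ-≡ (perpCount A u) _ _ (trans (cong (weight A′ u +_) (N≡ u))
                  (trans (weight+perpCount A′ u) (sym (weight+perpCount A u)))))

    perpCount⇔fibreSum : (∀ u → perpCount A u ≡ perpCount A′ u) ⇔ (∀ x → fibreSum A x ≡ fibreSum A′ x)
    perpCount⇔fibreSum = mk⇔ (perpCount⇒fibreSum A A′) (fibreSum⇒perpCount A A′)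

    fibreSum⇔weightFun : (∀ x → fibreSum A x ≡ fibreSum A′ x) ⇔ (∀ x → weightFun A x ≡ weightFun A′ x)
    fibreSum⇔weightFun = mk⇔
      (λ F≡ x → trans (weightFun≡frac A x) (trans (cong frac (F≡ x)) (sym (weightFun≡frac A′ x))))
      (λ w≡ x → frac-injective (trans (sym (weightFun≡frac A x)) (trans (w≡ x) (weightFun≡frac A′ x))))

proposition14 : (E : FieldExt) {n : ℕ} (B : Basis E n) {k m : ℕ} →
    let open Ops E B in
    (C : LVec m → Set) (A A' : Mat k m) (f : Sub C → LVec m) →
    IsGeneratorMatrix C A → IsKLinear C f → Represents C f A A' →
    IsIsometry C f ⇔ (∀ (u : KVec k) → weightFun A u ≡ weightFun A' u)
proposition14 E B C A A' f generator linear represents =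
  isometry⇔weight-preserving C A A' f generator linear represents ⟨ ⇔.trans ⟩
  weight-preserving⇔perpCount A A' ⟨ ⇔.trans ⟩
  perpCount⇔fibreSum A A' ⟨ ⇔.trans ⟩
  fibreSum⇔weightFun A A'
  where open CodeIsometry E B
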